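{- Let $d\ge 2$ and let $\mathcal{N}$ be a finite set of nonterminals. For each $A\in\mathcal{N}$ let $\ell_{d-1}(A)$ be the increasing list of those documents $e\in[1,d-1]$ in which $A$ appears, and fix an order $A_1,\dots,A_q$ of $\mathcal{N}$. Let $L=\ell_{d-1}(A_1)\cdots\ell_{d-1}(A_q)$ (concatenation) and let $E$ be its array of previous occurrences. Suppose that the set of nonterminals of $\mathcal{N}$ appearing in document $d$ equals the set of nonterminals of $\mathcal{N}$ appearing in document $d-1$. Define $\ell_d(A)=\ell_{d-1}(A)\cdot d$ (append $d$) if $A$ appears in document $d$, and $\ell_d(A)=\ell_{d-1}(A)$ otherwise, let $L'=\ell_d(A_1)\cdots\ell_d(A_q)$ (same order) and let $E'$ be the array of previous occurrences of $L'$. Then $E'$ has no more maximal runs of nondecreasing values than $E$; that is, inserting document $d$ in the inverted lists creates no new run.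
   Context: For an array $L[1,t]$ of integers, its array of previous occurrences $E[1,t]$ is defined by $E[k]=\max\{l<k : L[l]=L[k]\}$, or $E[k]=0$ if no such $l$ exists. A maximal run of nondecreasing values in $E$ is a maximal interval $E[a,b]$ with $E[a]\le E[a+1]\le\dots\le E[b]$; the number of runs is one plus the number of positions $k$ with $E[k+1]<E[k]$. -}

module Defs where

open import Data.Nat using (ℕ; zero; suc; _+_; _≡ᵇ_; _<ᵇ_)
open import Data.Bool using (Bool; true; false; if_then_else_)
open import Data.Fin using (Fin)
open import Data.List using (List; []; _∷_; _++_; [_]; filter; concatMap; map; allFin; upTo)
open import Relation.Nullary.Decidable using (does)
open import Relation.Binary.PropositionalEquality using (_≡_)
open import Data.Bool.Properties using () renaming (_≟_ to _≟ᵇ_)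

docs : ℕ → List ℕ
docs n = map suc (upTo n)

-- ℓ(A) for document range [1,n]: increasing list of documents e ∈ [1,n]
-- such that nonterminal A appears in document e.
-- `appears A e = true` means nonterminal A appears in document e.
invList : {q : ℕ} → (Fin q → ℕ → Bool) → ℕ → Fin q → List ℕ
invList appears n A = filter (λ e → appears A e ≟ᵇ true) (docs n)

-- Concatenation ℓ(A_1) ⋯ ℓ(A_q), with A_1..A_q the order of Fin q.
concatInv : {q : ℕ} → (Fin q → ℕ → Bool) → ℕ → List ℕ
concatInv {q} appears n = concatMap (invList appears n) (allFin q)

extInv : {q : ℕ} → (Fin q → ℕ → Bool) → ℕ → Fin q → List ℕ
extInv appears d A =
  if appears A d then invList appears (d Data.Nat.∸ 1) A ++ [ d ]
                 else invList appears (d Data.Nat.∸ 1) A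

concatExt : {q : ℕ} → (Fin q → ℕ → Bool) → ℕ → List ℕ
concatExt {q} appears d = concatMap (extInv appears d) (allFin q)

-- lastOcc x P : the largest (1-based) position l in P with P[l] = x, or 0.
lastOcc : ℕ → List ℕ → ℕ
lastOcc x [] = 0
lastOcc x (y ∷ ys) with lastOcc x ys
... | suc k = suc (suc k)
... | zero  = if x ≡ᵇ y then 1 else 0

-- Array of previous occurrences: E[k] = max{l < k : L[l] = L[k]}, or 0.
-- `prevOccAux P L` processes L with the already-seen prefix P.
prevOccAux : List ℕ → List ℕ → List ℕ
prevOccAux pre [] = []
prevOccAux pre (x ∷ xs) = lastOcc x pre ∷ prevOccAux (pre ++ [ x ]) xs

prevOcc : List ℕ → List ℕ
prevOcc L = prevOccAux [] L

descents : List ℕ → ℕ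
descents [] = 0
descents (x ∷ []) = 0
descents (x ∷ y ∷ ys) = (if y <ᵇ x then 1 else 0) + descents (y ∷ ys)

-- number of maximal nondecreasing runs = 1 + number of descents
runs : List ℕ → ℕ
runs E = suc (descents E)

module Submission where

-- Since d - 1 is the last entry of ℓ_{d-1}(A) exactly when A appears in document d - 1,
-- and hence exactly when A appears in document d, the list L' arises from L by inserting
-- a fresh value d right after every occurrence of D = d - 1. This insertion shifts
-- positions monotonically, so it preserves the order of the last occurrences of old
-- values, and the last d sits right after the last D. Reading E and E' in parallel, a
-- step of E' between old entries descends only if the corresponding step of E does. An
-- inserted entry never descends from its D, and the entry after it cannot descend from
-- it either: in L the last occurrences of distinct values are distinct positions, so a
-- nondescent E[k] ≤ E[k+1] after a D is strict and survives the shift by one.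

open import Defs
open import Data.Nat using (ℕ; zero; suc; _∸_; _≤_; _≰_; _<ᵇ_; _≡ᵇ_; z≤n; s≤s)
open import Data.Nat.Properties
  using (_≟_; ≡ᵇ⇒≡; ≡⇒≡ᵇ; <ᵇ-reflects-<; ≤-refl; ≤-trans; ≤-reflexive; n≤1+n; m≤n⇒m≤1+n;
         1+n≰n; 1+n≢n; <⇒≱; ≮⇒≥; <⇒≢; module ≤-Reasoning)
open import Data.Bool using (Bool; true; false; T; if_then_else_)
open import Data.Bool.Properties using () renaming (_≟_ to _≟ᵇ_)
open import Data.Unit using (tt)
open import Data.Empty using (⊥-elim)
open import Data.Product using (_,_)
open import Data.Fin using (Fin)
open import Data.List using (List; []; _∷_; _∷ʳ_; _++_; [_]; length; map; filter; concatMap; upTo; allFin)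
open import Data.List.Properties using (++-assoc; ++-identityʳ; upTo-∷ʳ; map-++; filter-++; concatMap-cong)
open import Data.List.Reverse using (Reverse; []; _∶_∶ʳ_; reverseView)
open import Data.List.Relation.Unary.All as All using (All; []; _∷_; universal)
open import Data.List.Relation.Unary.All.Properties
  using (map⁺; applyUpTo⁺₁; filter⁺; concat⁺; ∷ʳ⁺; ∷ʳ⁻)
open import Function using (_∘_; id)
open import Relation.Nullary using (yes; no)
open import Relation.Nullary.Reflects using (ofʸ; ofⁿ)
open import Relation.Binary.PropositionalEquality
  using (_≡_; _≢_; refl; sym; trans; cong; subst; subst₂; ≢-sym)

lastOcc≤length : ∀ x P → lastOcc x P ≤ length P
lastOcc≤length x []      = z≤n
lastOcc≤length x (y ∷ P) with lastOcc x P | lastOcc≤length x P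
... | suc _ | k≤P = s≤s k≤P
... | zero  | _ with x ≡ᵇ y
...   | true  = s≤s z≤n
...   | false = z≤n

lastOcc-∷ʳ-self : ∀ x P → lastOcc x (P ∷ʳ x) ≡ suc (length P)
lastOcc-∷ʳ-self x [] with x ≡ᵇ x in x≡ᵇx
... | true  = refl
... | false = ⊥-elim (subst T x≡ᵇx (≡⇒≡ᵇ x x refl))
lastOcc-∷ʳ-self x (y ∷ P) rewrite lastOcc-∷ʳ-self x P = refl

lastOcc-∷ʳ-other : ∀ {x z} P → x ≢ z → lastOcc x (P ∷ʳ z) ≡ lastOcc x P
lastOcc-∷ʳ-other {x} {z} [] x≢z with x ≡ᵇ z in x≡ᵇz
... | true  = ⊥-elim (x≢z (≡ᵇ⇒≡ x z (subst T (sym x≡ᵇz) tt)))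
... | false = refl
lastOcc-∷ʳ-other {x} (y ∷ P) x≢z with lastOcc x P | lastOcc-∷ʳ-other P x≢z
... | zero  | eq rewrite eq = refl
... | suc _ | eq rewrite eq = refl

lastOcc-∷ʳ-max : ∀ x y P → lastOcc x (P ∷ʳ y) ≤ lastOcc y (P ∷ʳ y)
lastOcc-∷ʳ-max x y P with x ≟ y
... | yes refl = ≤-refl
... | no x≢y rewrite lastOcc-∷ʳ-other P x≢y | lastOcc-∷ʳ-self y P =
  ≤-trans (lastOcc≤length x P) (n≤1+n _)

lastOcc-∷ʳ-max-strict : ∀ {x y} P → y ≢ x → lastOcc x (P ∷ʳ x) ≰ lastOcc y (P ∷ʳ x)
lastOcc-∷ʳ-max-strict {x} {y} P y≢x rewrite lastOcc-∷ʳ-self x P | lastOcc-∷ʳ-other P y≢x =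
  λ x≤y → 1+n≰n (≤-trans x≤y (lastOcc≤length y P))

<ᵇ-false : ∀ {m n} → n ≤ m → (m <ᵇ n) ≡ false
<ᵇ-false {m} {n} n≤m with m <ᵇ n | <ᵇ-reflects-< m n
... | true  | ofʸ m<n = ⊥-elim (<⇒≱ m<n n≤m)
... | false | _       = refl

descents-≤-∷ : ∀ {v w} E → v ≤ w → descents (v ∷ w ∷ E) ≡ descents (w ∷ E)
descents-≤-∷ E v≤w rewrite <ᵇ-false v≤w = refl

descents-0-∷ : ∀ E → descents (0 ∷ E) ≡ descents E
descents-0-∷ []      = refl
descents-0-∷ (v ∷ E) = descents-≤-∷ E z≤n

descents-∷-mono : ∀ {a a' v v'} E E' → (a ≤ v → a' ≤ v') →
  descents (v' ∷ E') ≤ descents (v ∷ E) → descents (a' ∷ v' ∷ E') ≤ descents (a ∷ v ∷ E)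
descents-∷-mono {a} {a'} {v} {v'} E E' step rest with v <ᵇ a | <ᵇ-reflects-< v a
... | true  | _ with v' <ᵇ a'
...   | true  = s≤s rest
...   | false = m≤n⇒m≤1+n rest
descents-∷-mono {a} {a'} {v} {v'} E E' step rest | false | ofⁿ v≮a
  rewrite <ᵇ-false (step (≮⇒≥ v≮a)) = rest

insertAfter : ℕ → ℕ → List ℕ → List ℕ
insertAfter D d []       = []
insertAfter D d (x ∷ xs) with x ≟ D
... | yes _ = x ∷ d ∷ insertAfter D d xs
... | no  _ = x ∷ insertAfter D d xs

module _ {D d : ℕ} where

  insertAfter-++ : ∀ xs ys → insertAfter D d (xs ++ ys) ≡ insertAfter D d xs ++ insertAfter D d ys
  insertAfter-++ []       ys = refl
  insertAfter-++ (x ∷ xs) ys with x ≟ D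
  ... | yes _ = cong (λ zs → x ∷ d ∷ zs) (insertAfter-++ xs ys)
  ... | no  _ = cong (x ∷_) (insertAfter-++ xs ys)

  insertAfter-concatMap : ∀ {A : Set} (f : A → List ℕ) xs →
    insertAfter D d (concatMap f xs) ≡ concatMap (insertAfter D d ∘ f) xs
  insertAfter-concatMap f []       = refl
  insertAfter-concatMap f (x ∷ xs) =
    trans (insertAfter-++ (f x) (concatMap f xs))
          (cong (insertAfter D d (f x) ++_) (insertAfter-concatMap f xs))

  insertAfter-∷ʳ-self : ∀ xs → insertAfter D d (xs ∷ʳ D) ≡ insertAfter D d xs ∷ʳ D ∷ʳ d
  insertAfter-∷ʳ-self xs with D ≟ D | insertAfter-++ xs [ D ]
  ... | yes _   | eq = trans eq (sym (++-assoc (insertAfter D d xs) [ D ] [ d ]))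
  ... | no D≢D | _  = ⊥-elim (D≢D refl)

  insertAfter-∷ʳ-other : ∀ {z} xs → z ≢ D → insertAfter D d (xs ∷ʳ z) ≡ insertAfter D d xs ∷ʳ z
  insertAfter-∷ʳ-other {z} xs z≢D with z ≟ D | insertAfter-++ xs [ z ]
  ... | yes z≡D | _  = ⊥-elim (z≢D z≡D)
  ... | no _    | eq = eq

  insertAfter-fresh : ∀ {xs} → All (_≢ D) xs → insertAfter D d xs ≡ xs
  insertAfter-fresh []                      = refl
  insertAfter-fresh {x ∷ _} (x≢D ∷ xs≢D) with x ≟ D
  ... | yes x≡D = ⊥-elim (x≢D x≡D)
  ... | no _    = cong (x ∷_) (insertAfter-fresh xs≢D)

module _ {D d : ℕ} (D≢d : D ≢ d) where

  private
    ins : List ℕ → List ℕ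
    ins = insertAfter D d

  lastOcc-insertAfter-∷ʳ : ∀ {u} xs z → u ≢ d → lastOcc u (ins (xs ∷ʳ z)) ≡ lastOcc u (ins xs ∷ʳ z)
  lastOcc-insertAfter-∷ʳ xs z u≢d with z ≟ D
  ... | yes refl rewrite insertAfter-∷ʳ-self {D} {d} xs = lastOcc-∷ʳ-other (ins xs ∷ʳ D) u≢d
  ... | no z≢D   rewrite insertAfter-∷ʳ-other {D} {d} xs z≢D = refl

  lastOcc-insertAfter-mono : ∀ {x y} P → x ≢ d → y ≢ d →
    lastOcc x P ≤ lastOcc y P → lastOcc x (ins P) ≤ lastOcc y (ins P)
  lastOcc-insertAfter-mono {x} {y} P x≢d y≢d = go (reverseView P)
    where
    go : ∀ {P} → Reverse P → lastOcc x P ≤ lastOcc y P → lastOcc x (ins P) ≤ lastOcc y (ins P)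
    go [] _ = z≤n
    go (Q ∶ rQ ∶ʳ z) x≤y with y ≟ z
    ... | yes refl rewrite lastOcc-insertAfter-∷ʳ Q y x≢d | lastOcc-insertAfter-∷ʳ Q y y≢d =
      lastOcc-∷ʳ-max x y (ins Q)
    ... | no y≢z with x ≟ z
    ...   | yes refl = ⊥-elim (lastOcc-∷ʳ-max-strict Q y≢z x≤y)
    ...   | no x≢z
      rewrite lastOcc-insertAfter-∷ʳ Q z x≢d | lastOcc-insertAfter-∷ʳ Q z y≢d
            | lastOcc-∷ʳ-other (ins Q) x≢z | lastOcc-∷ʳ-other (ins Q) y≢z
            | lastOcc-∷ʳ-other Q x≢z | lastOcc-∷ʳ-other Q y≢z = go rQ x≤y

  lastOcc-insertAfter-mono-inserted : ∀ {y} P → y ≢ D → y ≢ d → All (_≢ d) P →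
    lastOcc D P ≤ lastOcc y P → lastOcc d (ins P) ≤ lastOcc y (ins P)
  lastOcc-insertAfter-mono-inserted {y} P y≢D y≢d = go (reverseView P)
    where
    go : ∀ {P} → Reverse P → All (_≢ d) P →
      lastOcc D P ≤ lastOcc y P → lastOcc d (ins P) ≤ lastOcc y (ins P)
    go [] _ _ = z≤n
    go (Q ∶ rQ ∶ʳ z) fresh D≤y with ∷ʳ⁻ fresh | y ≟ z
    ... | _ | yes refl rewrite insertAfter-∷ʳ-other {D} {d} Q y≢D =
      lastOcc-∷ʳ-max d y (ins Q)
    ... | freshQ , z≢d | no y≢z with z ≟ D
    ...   | yes refl = ⊥-elim (lastOcc-∷ʳ-max-strict Q y≢z D≤y)
    ...   | no z≢D
      rewrite insertAfter-∷ʳ-other {D} {d} Q z≢D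
            | lastOcc-∷ʳ-other (ins Q) (≢-sym z≢d) | lastOcc-∷ʳ-other (ins Q) y≢z
            | lastOcc-∷ʳ-other Q (≢-sym z≢D) | lastOcc-∷ʳ-other Q y≢z = go rQ freshQ D≤y

  lastOcc-insertAfter-anchor≤inserted : ∀ P → All (_≢ d) P → lastOcc D (ins P) ≤ lastOcc d (ins P)
  lastOcc-insertAfter-anchor≤inserted P = go (reverseView P)
    where
    go : ∀ {P} → Reverse P → All (_≢ d) P → lastOcc D (ins P) ≤ lastOcc d (ins P)
    go [] _ = z≤n
    go (Q ∶ rQ ∶ʳ z) fresh with ∷ʳ⁻ fresh | z ≟ D
    ... | _ | yes refl rewrite insertAfter-∷ʳ-self {D} {d} Q =
      lastOcc-∷ʳ-max D d (ins Q ∷ʳ D)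
    ... | freshQ , z≢d | no z≢D
      rewrite insertAfter-∷ʳ-other {D} {d} Q z≢D
            | lastOcc-∷ʳ-other (ins Q) (≢-sym z≢D) | lastOcc-∷ʳ-other (ins Q) (≢-sym z≢d) =
      go rQ freshQ

  -- Invariant of the simulation below: a and a' are the last entries produced so far of
  -- the previous-occurrence arrays of P and of ins P.
  Dominates : ℕ → ℕ → List ℕ → Set
  Dominates a a' P = ∀ y → y ≢ d → a ≤ lastOcc y P → a' ≤ lastOcc y (ins P)

  dominates-∷ʳ : ∀ {x b} P → x ≢ d → b ≤ length (ins P) →
    (∀ y → y ≢ x → y ≢ d → lastOcc x P ≤ lastOcc y P → b ≤ lastOcc y (ins P)) →
    Dominates (lastOcc x P) b (P ∷ʳ x)
  dominates-∷ʳ {x} P x≢d b≤ later y y≢d x≤y with y ≟ x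
  ... | yes refl rewrite lastOcc-insertAfter-∷ʳ P y y≢d | lastOcc-∷ʳ-self y (ins P) =
    ≤-trans b≤ (n≤1+n _)
  ... | no y≢x rewrite lastOcc-insertAfter-∷ʳ P x y≢d | lastOcc-∷ʳ-other (ins P) y≢x
                     | lastOcc-∷ʳ-other P y≢x = later y y≢x y≢d x≤y

  descents-prevOccAux-insertAfter : ∀ xs {P P' a a'} → P' ≡ ins P → All (_≢ d) P → All (_≢ d) xs →
    Dominates a a' P → descents (a' ∷ prevOccAux P' (ins xs)) ≤ descents (a ∷ prevOccAux P xs)
  descents-prevOccAux-insertAfter []       _    _     _                 _   = z≤n
  descents-prevOccAux-insertAfter (x ∷ xs) {P} refl fresh (x≢d ∷ freshXs) dom with x ≟ D
  ... | no x≢D =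
    descents-∷-mono (prevOccAux (P ∷ʳ x) xs) (prevOccAux (ins P ∷ʳ x) (ins xs)) (dom x x≢d)
      (descents-prevOccAux-insertAfter xs (sym (insertAfter-∷ʳ-other P x≢D)) (∷ʳ⁺ fresh x≢d) freshXs
        (dominates-∷ʳ P x≢d (lastOcc≤length x (ins P))
          (λ y _ y≢d → lastOcc-insertAfter-mono P x≢d y≢d)))
  ... | yes refl rewrite lastOcc-∷ʳ-other (ins P) (≢-sym D≢d) =
    descents-∷-mono (prevOccAux (P ∷ʳ D) xs) (lastOcc d (ins P) ∷ E') (dom D D≢d)
      (≤-trans (≤-reflexive (descents-≤-∷ E' (lastOcc-insertAfter-anchor≤inserted P fresh)))
        (descents-prevOccAux-insertAfter xs (sym (insertAfter-∷ʳ-self P)) (∷ʳ⁺ fresh D≢d) freshXs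
          (dominates-∷ʳ P D≢d (lastOcc≤length d (ins P))
            (λ y y≢D y≢d → lastOcc-insertAfter-mono-inserted P y≢D y≢d fresh))))
    where E' = prevOccAux (ins P ∷ʳ D ∷ʳ d) (ins xs)

  descents-prevOcc-insertAfter : ∀ L → All (_≢ d) L →
    descents (prevOcc (insertAfter D d L)) ≤ descents (prevOcc L)
  descents-prevOcc-insertAfter L fresh =
    subst₂ _≤_ (descents-0-∷ (prevOcc (ins L))) (descents-0-∷ (prevOcc L))
      (descents-prevOccAux-insertAfter L refl [] fresh (λ _ _ _ → z≤n))

docs-suc : ∀ m → docs (suc m) ≡ docs m ∷ʳ suc m
docs-suc m = trans (cong (map suc) (sym (upTo-∷ʳ m))) (map-++ suc (upTo m) [ m ])

docs-≤ : ∀ m → All (_≤ m) (docs m)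
docs-≤ m = map⁺ (applyUpTo⁺₁ id m id)

module _ {q : ℕ} (appears : Fin q → ℕ → Bool) where

  invList-≢-suc : ∀ m A → All (_≢ suc m) (invList appears m A)
  invList-≢-suc m A =
    filter⁺ (λ e → appears A e ≟ᵇ true) (All.map (λ e≤m → <⇒≢ (s≤s e≤m)) (docs-≤ m))

  concatInv-≢-suc : ∀ m → All (_≢ suc m) (concatInv appears m)
  concatInv-≢-suc m = concat⁺ (map⁺ (universal (invList-≢-suc m) (allFin q)))

  invList-suc : ∀ m A → invList appears (suc m) A ≡
    (if appears A (suc m) then invList appears m A ∷ʳ suc m else invList appears m A)
  invList-suc m A with appears A (suc m) | filter-++ (λ e → appears A e ≟ᵇ true) (docs m) [ suc m ]
  ... | true  | eq = trans (cong (filter _) (docs-suc m)) eq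
  ... | false | eq = trans (cong (filter _) (docs-suc m)) (trans eq (++-identityʳ _))

  extInv-insertAfter : ∀ n A → appears A (suc (suc n)) ≡ appears A (suc n) →
    extInv appears (suc (suc n)) A ≡ insertAfter (suc n) (suc (suc n)) (invList appears (suc n) A)
  extInv-insertAfter n A same rewrite same | invList-suc n A with appears A (suc n)
  ... | true  = sym (trans (insertAfter-∷ʳ-self (invList appears n A))
                           (cong (λ xs → xs ∷ʳ suc n ∷ʳ suc (suc n)) (insertAfter-fresh (invList-≢-suc n A))))
  ... | false = sym (insertAfter-fresh (invList-≢-suc n A))

  concatExt-insertAfter : ∀ n → (∀ A → appears A (suc (suc n)) ≡ appears A (suc n)) →
    concatExt appears (suc (suc n)) ≡ insertAfter (suc n) (suc (suc n)) (concatInv appears (suc n))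
  concatExt-insertAfter n same =
    trans (concatMap-cong (λ A → extInv-insertAfter n A (same A)) (allFin q))
          (sym (insertAfter-concatMap (invList appears (suc n)) (allFin q)))

lemma1 : (d q : ℕ) → 2 ≤ d → (appears : Fin q → ℕ → Bool) →
    ((A : Fin q) → appears A d ≡ appears A (d ∸ 1)) →
    runs (prevOcc (concatExt appears d)) ≤ runs (prevOcc (concatInv appears (d ∸ 1)))
lemma1 (suc (suc n)) q (s≤s (s≤s _)) appears same = s≤s (begin
  descents (prevOcc (concatExt appears (suc (suc n))))
    ≡⟨ cong (descents ∘ prevOcc) (concatExt-insertAfter appears n same) ⟩
  descents (prevOcc (insertAfter (suc n) (suc (suc n)) (concatInv appears (suc n))))
    ≤⟨ descents-prevOcc-insertAfter (≢-sym 1+n≢n) _ (concatInv-≢-suc appears (suc n)) ⟩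
  descents (prevOcc (concatInv appears (suc n))) ∎)
  where open ≤-Reasoning
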